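{- Let $\mathsf{C}=(A,r,X)$ and $\mathsf{C}'=(A',r',X')$ be discrete extensional Chu spaces over $\Sigma$ with $|A|=|A'|$. Then $\mathsf{C}$ and $\mathsf{C}'$ are isomorphic in $\mathbf{iC}$.
   Context: $\Sigma$ is a set containing at least two distinct elements, denoted $0$ and $1$. A Chu space over $\Sigma$ is a triple $(A,r,X)$ with sets $A,X$ and a function $r:A\times X\to\Sigma$. A morphism $\varphi=(\varphi^+,\varphi^-):(A,r,X)\to(B,s,Y)$ consists of functions $\varphi^+:A\to B$, $\varphi^-:Y\to X$ with $s(\varphi^+(a),y)=r(a,\varphi^-(y))$ for all $a,y$; composition is $\varphi_2\circ\varphi_1=(\varphi_2^+\circ\varphi_1^+,\varphi_1^-\circ\varphi_2^-)$. $(A,r,X)$ is extensional if for $x,y\in X$, $r(-,x)=r(-,y)$ implies $x=y$; it is discrete if for every function $f:A\to\Sigma$ there is $x\in X$ with $f=r(-,x)$. $\mathbf{C}$ is the category of all Chu spaces over $\Sigma$, and $\mathbf{iC}$ its subcategory with the same objects whose morphisms are the monomorphisms of $\mathbf{C}$. -}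

module Defs where

open import Level using (Level; _⊔_) renaming (suc to lsuc)
open import Relation.Binary.PropositionalEquality using (_≡_)
open import Data.Product using (Σ; _×_; _,_)
open import Function.Bundles using (_↔_)

module _ {s : Level} (Σ₀ : Set s) where

  record Chu (ℓ : Level) : Set (s ⊔ lsuc ℓ) where
    constructor chu
    field
      pts  : Set ℓ
      st   : Set ℓ
      rel  : pts → st → Σ₀
  open Chu public

  record Hom {ℓ : Level} (C D : Chu ℓ) : Set (s ⊔ ℓ) where
    constructor hom
    field
      fwd : pts C → pts D
      bwd : st D → st C
      adj : ∀ a y → rel D (fwd a) y ≡ rel C a (bwd y)
  open Hom public

  idHom : ∀ {ℓ} (C : Chu ℓ) → Hom C C
  idHom C = hom (λ a → a) (λ x → x) (λ a y → _≡_.refl)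

  _∘H_ : ∀ {ℓ} {C D E : Chu ℓ} → Hom D E → Hom C D → Hom C E
  _∘H_ {C = C} {D} {E} g f =
    hom (λ a → fwd g (fwd f a)) (λ z → bwd f (bwd g z))
        (λ a z → Relation.Binary.PropositionalEquality.trans
                   (adj g (fwd f a) z) (adj f a (bwd g z)))

  -- Equality of morphisms: both component functions agree (pointwise,
  -- since function extensionality is not available).
  _≈H_ : ∀ {ℓ} {C D : Chu ℓ} → Hom C D → Hom C D → Set ℓ
  f ≈H g = (∀ a → fwd f a ≡ fwd g a) × (∀ y → bwd f y ≡ bwd g y)

  IsMono : ∀ {ℓ} {C D : Chu ℓ} → Hom C D → Set (s ⊔ lsuc ℓ)
  IsMono {ℓ} {C} {D} f =
    ∀ (E : Chu ℓ) (g h : Hom E C) → (f ∘H g) ≈H (f ∘H h) → g ≈H h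

  -- Morphisms of iC: monomorphisms of C.
  record iHom {ℓ : Level} (C D : Chu ℓ) : Set (s ⊔ lsuc ℓ) where
    constructor ihom
    field
      mor  : Hom C D
      mono : IsMono mor
  open iHom public

  record IsoIC {ℓ : Level} (C D : Chu ℓ) : Set (s ⊔ lsuc ℓ) where
    field
      to     : iHom C D
      from   : iHom D C
      from∘to : (mor from ∘H mor to) ≈H idHom C
      to∘from : (mor to ∘H mor from) ≈H idHom D

  Extensional : ∀ {ℓ} → Chu ℓ → Set (s ⊔ ℓ)
  Extensional C = ∀ x y → (∀ a → rel C a x ≡ rel C a y) → x ≡ y

  Discrete : ∀ {ℓ} → Chu ℓ → Set (s ⊔ ℓ)
  Discrete C = ∀ (f : pts C → Σ₀) → Σ (st C) (λ x → ∀ a → f a ≡ rel C a x)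

-- A bijection t : A → A' is the forward part of a morphism C → C' as soon as C is
-- discrete: the backward image of x' is the state of C realising r'(t -, x').
-- Doing the same with t⁻¹ gives a morphism back, and extensionality forces the
-- backward parts to be mutually inverse, because they are determined by the rows
-- they realise. Morphisms with a left inverse are monomorphisms, so this pair is
-- an isomorphism in iC.
module Submission where

open import Defs
open import Level using (Level)
open import Relation.Binary.PropositionalEquality
  using (_≡_; sym; cong; module ≡-Reasoning)
open import Relation.Nullary using (¬_)
open import Function.Bundles using (_↔_; Inverse)
open import Data.Product using (_,_; proj₁; proj₂)

module _ {s ℓ : Level} {Σ₀ : Set s} where

  leftInverse⇒mono : {C D : Chu Σ₀ ℓ} (f : Hom Σ₀ C D) (g : Hom Σ₀ D C) →
                     _≈H_ Σ₀ (_∘H_ Σ₀ g f) (idHom Σ₀ C) → IsMono Σ₀ f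
  leftInverse⇒mono f g (gf⁺ , gf⁻) E h k (fh≈fk⁺ , fh≈fk⁻) =
    (λ e → begin
      fwd h e                   ≡⟨ sym (gf⁺ (fwd h e)) ⟩
      fwd g (fwd f (fwd h e))   ≡⟨ cong (fwd g) (fh≈fk⁺ e) ⟩
      fwd g (fwd f (fwd k e))   ≡⟨ gf⁺ (fwd k e) ⟩
      fwd k e                   ∎) ,
    (λ x → begin
      bwd h x                   ≡⟨ cong (bwd h) (sym (gf⁻ x)) ⟩
      bwd h (bwd f (bwd g x))   ≡⟨ fh≈fk⁻ (bwd g x) ⟩
      bwd k (bwd f (bwd g x))   ≡⟨ cong (bwd k) (gf⁻ x) ⟩
      bwd k x                   ∎)
    where open ≡-Reasoning

  discrete⇒hom : {C D : Chu Σ₀ ℓ} → Discrete Σ₀ C → (pts C → pts D) → Hom Σ₀ C D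
  discrete⇒hom {C} {D} dC t =
    hom t (λ y → proj₁ (dC (λ a → rel D (t a) y)))
          (λ a y → proj₂ (dC (λ a → rel D (t a) y)) a)

  extensional⇒bwd-inverse : {C D : Chu Σ₀ ℓ} → Extensional Σ₀ C →
                            (f : Hom Σ₀ C D) (g : Hom Σ₀ D C) →
                            (∀ a → fwd g (fwd f a) ≡ a) →
                            ∀ x → bwd f (bwd g x) ≡ x
  extensional⇒bwd-inverse {C} {D} eC f g gf⁺ x = eC _ _ λ a → begin
    rel C a (bwd f (bwd g x))   ≡⟨ sym (adj f a (bwd g x)) ⟩
    rel D (fwd f a) (bwd g x)   ≡⟨ sym (adj g (fwd f a) x) ⟩
    rel C (fwd g (fwd f a)) x   ≡⟨ cong (λ b → rel C b x) (gf⁺ a) ⟩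
    rel C a x                   ∎
    where open ≡-Reasoning

  extensional⇒inverse : {C D : Chu Σ₀ ℓ} → Extensional Σ₀ C →
                        (f : Hom Σ₀ C D) (g : Hom Σ₀ D C) →
                        (∀ a → fwd g (fwd f a) ≡ a) →
                        _≈H_ Σ₀ (_∘H_ Σ₀ g f) (idHom Σ₀ C)
  extensional⇒inverse eC f g gf⁺ = gf⁺ , extensional⇒bwd-inverse eC f g gf⁺

  inverses⇒IsoIC : {C D : Chu Σ₀ ℓ} (f : Hom Σ₀ C D) (g : Hom Σ₀ D C) →
                   _≈H_ Σ₀ (_∘H_ Σ₀ g f) (idHom Σ₀ C) →
                   _≈H_ Σ₀ (_∘H_ Σ₀ f g) (idHom Σ₀ D) →
                   IsoIC Σ₀ C D
  inverses⇒IsoIC f g gf fg = record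
    { to      = ihom f (leftInverse⇒mono f g gf)
    ; from    = ihom g (leftInverse⇒mono g f fg)
    ; from∘to = gf
    ; to∘from = fg
    }

mainTheorem10 : ∀ {s ℓ : Level} (Σ₀ : Set s) (𝟎 𝟏 : Σ₀) → ¬ (𝟎 ≡ 𝟏) →
    (C C' : Chu Σ₀ ℓ) →
    Discrete Σ₀ C → Extensional Σ₀ C →
    Discrete Σ₀ C' → Extensional Σ₀ C' →
    (pts C ↔ pts C') →
    IsoIC Σ₀ C C'
mainTheorem10 Σ₀ _ _ _ C C' dC eC dC' eC' A↔A' =
  inverses⇒IsoIC f g
    (extensional⇒inverse eC f g strictlyInverseʳ)
    (extensional⇒inverse eC' g f strictlyInverseˡ)
  where
  open Inverse A↔A'
  f : Hom Σ₀ C C'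
  f = discrete⇒hom dC to
  g : Hom Σ₀ C' C
  g = discrete⇒hom dC' from
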